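{- The set $L_{ -1,\emptyset}$ of polynomials in $\mathbb{Z}[x]$ of degree at least 1 that are locally nilpotent at $-1$ consists exactly of the following polynomials: (1) $(x+1)p(x)$ with $p(x)\in\mathbb{Z}[x]\setminus\{0\}$ (nilpotent at $-1$ of nilpotency index 1); (2) $-2x-4+p(x)(x+1)(x+2)$ with $p(x)\in\mathbb{Z}[x]$ (nilpotent at $-1$ of nilpotency index 2); (3) $2x^2+7x+3+p(x)(x+1)(x+2)(x+3)$ with $p(x)\in\mathbb{Z}[x]$ (nilpotent at $-1$ of nilpotency index 3); (4) $x-1$ (locally nilpotent at $-1$ but not nilpotent at $-1$).
   Context: $\mathbb{N}$ denotes the positive integers. For $u\in\mathbb{Z}[x]$ of degree at least 1, $u^{(1)}=u$ and $u^{(n+1)}=u\circ u^{(n)}$. $u$ is locally nilpotent at $r\in\mathbb{Z}$ if for every prime $p$ there is $m\in\mathbb{N}$ with $u^{(m)}(r)\equiv 0\pmod p$; $L_{r,\emptyset}$ denotes the set of all such polynomials (of any degree $\ge1$). $u$ is nilpotent at $r$ if $u^{(n)}(r)=0$ for some $n\in\mathbb{N}$, and the least such $n$ is the nilpotency index. -}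

module Defs where

open import Data.Nat using (ℕ; zero; suc; _≤_; _<_)
open import Data.Nat.Primality using (Prime)
open import Data.Integer using (ℤ; +_; -_; _+_; _*_)
open import Data.Integer.Divisibility using (_∣_)
open import Data.List using (List; []; _∷_; map)
open import Data.Product using (Σ; ∃; _×_)
open import Relation.Binary.PropositionalEquality using (_≡_; _≢_)
open import Relation.Nullary using (¬_)

-- Polynomials in ℤ[x] as coefficient lists (constant term first).
-- Two lists denote the same polynomial iff all their coefficients agree
-- (trailing zeros are irrelevant); see _≈ₚ_.
Poly : Set
Poly = List ℤ

coeff : Poly → ℕ → ℤ
coeff []      _       = + 0
coeff (a ∷ p) zero    = a
coeff (a ∷ p) (suc n) = coeff p n

infix 4 _≈ₚ_
_≈ₚ_ : Poly → Poly → Set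
p ≈ₚ q = ∀ n → coeff p n ≡ coeff q n

infixl 6 _+ₚ_
_+ₚ_ : Poly → Poly → Poly
[]      +ₚ q       = q
(a ∷ p) +ₚ []      = a ∷ p
(a ∷ p) +ₚ (b ∷ q) = (a + b) ∷ (p +ₚ q)

scaleₚ : ℤ → Poly → Poly
scaleₚ a p = map (a *_) p

infixl 7 _*ₚ_
_*ₚ_ : Poly → Poly → Poly
[]      *ₚ q = []
(a ∷ p) *ₚ q = scaleₚ a q +ₚ (+ 0 ∷ (p *ₚ q))

eval : Poly → ℤ → ℤ
eval []      x = + 0
eval (a ∷ p) x = a + x * eval p x

NonzeroPoly : Poly → Set
NonzeroPoly p = ∃ λ n → coeff p n ≢ + 0

DegGe1 : Poly → Set
DegGe1 p = ∃ λ n → coeff p (suc n) ≢ + 0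

X+ : ℤ → Poly
X+ c = c ∷ + 1 ∷ []

iter : (ℤ → ℤ) → ℕ → ℤ → ℤ
iter f zero    x = x
iter f (suc n) x = f (iter f n x)

LocallyNilpotentAt : ℤ → Poly → Set
LocallyNilpotentAt r u =
  ∀ (p : ℕ) → Prime p → ∃ λ m → 1 ≤ m × (+ p) ∣ iter (eval u) m r

NilpotentAt : ℤ → Poly → Set
NilpotentAt r u = ∃ λ n → 1 ≤ n × iter (eval u) n r ≡ + 0

NilpotencyIndex : ℤ → Poly → ℕ → Set
NilpotencyIndex r u n =
  1 ≤ n × iter (eval u) n r ≡ + 0 ×
  (∀ k → 1 ≤ k → k < n → iter (eval u) k r ≢ + 0)

Family1 : Poly → Set
Family1 u = Σ Poly λ p → NonzeroPoly p × u ≈ₚ X+ (+ 1) *ₚ p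

Family2 : Poly → Set
Family2 u = Σ Poly λ p →
  u ≈ₚ ((- (+ 4)) ∷ (- (+ 2)) ∷ []) +ₚ p *ₚ X+ (+ 1) *ₚ X+ (+ 2)

Family3 : Poly → Set
Family3 u = Σ Poly λ p →
  u ≈ₚ (+ 3 ∷ + 7 ∷ + 2 ∷ []) +ₚ p *ₚ X+ (+ 1) *ₚ X+ (+ 2) *ₚ X+ (+ 3)

xMinus1 : Poly
xMinus1 = X+ (- (+ 1))

module Submission where

open import Defs
open import Data.Integer using (+_; -_)
open import Data.Product using (_×_)
open import Data.Sum using (_⊎_)
open import Function.Bundles using (_⇔_)
open import Relation.Nullary using (¬_)

open import Data.Empty using (⊥-elim)
open import Data.Integer using (ℤ; -[1+_]; _+_; _*_; _-_; ∣_∣; _≟_)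
import Data.Integer.Properties as ℤ
open import Data.Integer.Divisibility.Signed using (_∣_; divides; ∣ᵤ⇒∣; ∣⇒∣ᵤ)
import Data.Integer.Divisibility.Signed as ℤ
import Data.Integer.Divisibility as Unsigned
open import Data.Integer.Tactic.RingSolver using (solve-∀)
open import Data.List using (List; []; _∷_; length)
open import Data.List.Membership.Propositional using (_∈_)
open import Data.List.Relation.Unary.All as All using (All; []; _∷_)
open import Data.List.Relation.Unary.AllPairs using ([]; _∷_)
open import Data.List.Relation.Unary.Any using (here; there)
open import Data.List.Relation.Unary.Unique.Propositional using (Unique)
open import Data.Nat using (ℕ; zero; suc; z≤n; s≤s; _!)
import Data.Nat as ℕ
import Data.Nat.Properties as ℕ
import Data.Nat.Divisibility as ℕ
open import Data.Nat.ListAction using (product)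
open import Data.Nat.Primality using (Prime; prime⇒nonZero; prime⇒nonTrivial; prime⇒irreducible)
open import Data.Nat.Primality.Factorisation using (factorise)
open import Data.Product using (Σ; ∃; _,_; uncurry)
open import Data.Sum using (inj₁; inj₂; [_,_]′)
open import Function using (id)
open import Function.Bundles using (mk⇔)
open import Relation.Nullary using (yes; no)
open import Relation.Binary.PropositionalEquality
  using (_≡_; _≢_; refl; sym; trans; cong; cong₂; subst; subst₂; module ≡-Reasoning)

-- Write aₙ = u⁽ⁿ⁾(-1). Suppose a₀, …, a_k are -1, …, -(k+1) and let X = a_{k+1}. For
-- 1 ≤ i ≤ k, a_k - a_{k-i} = -i divides u(a_k) - u(a_{k-i}), so i ∣ X + k + 2. A prime p
-- dividing X + j + 1 = a_{k+1} - a_j (j ≤ k) sends the orbit modulo p back into a₀, …, a_k,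
-- where local nilpotence forces a zero, so p ≤ k + 1. Elementary number theory then leaves
-- only X = -(k+2), or X = 0 with k ≤ 2. Hence the orbit reaches 0 after one, two or three
-- steps, which fixes u at -1, …, -k and so u modulo (x+1)⋯(x+k); or u(-n) = -n-1 for all n,
-- and u - (x - 1), having infinitely many roots, vanishes. The converse is a computation.

-- Polynomial arithmetic

[0]≈ₚ[] : (+ 0 ∷ []) ≈ₚ []
[0]≈ₚ[] zero    = refl
[0]≈ₚ[] (suc _) = refl

coeff-+ₚ : ∀ p q n → coeff (p +ₚ q) n ≡ coeff p n + coeff q n
coeff-+ₚ []      q       n       = sym (ℤ.+-identityˡ _)
coeff-+ₚ (a ∷ p) []      n       = sym (ℤ.+-identityʳ _)
coeff-+ₚ (a ∷ p) (b ∷ q) zero    = refl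
coeff-+ₚ (a ∷ p) (b ∷ q) (suc n) = coeff-+ₚ p q n

coeff-scaleₚ : ∀ a p n → coeff (scaleₚ a p) n ≡ a * coeff p n
coeff-scaleₚ a []      n       = sym (ℤ.*-zeroʳ a)
coeff-scaleₚ a (b ∷ p) zero    = refl
coeff-scaleₚ a (b ∷ p) (suc n) = coeff-scaleₚ a p n

coeff-*ₚX+ : ∀ p c n → coeff (p *ₚ X+ c) n ≡ coeff (+ 0 ∷ p) n + coeff p n * c
coeff-*ₚX+ []      c zero          = refl
coeff-*ₚX+ []      c (suc n)       = refl
coeff-*ₚX+ (a ∷ p) c zero          = trans (ℤ.+-identityʳ (a * c)) (sym (ℤ.+-identityˡ (a * c)))
coeff-*ₚX+ (a ∷ p) c (suc zero)    = begin
  coeff ((a * + 1 ∷ []) +ₚ p *ₚ X+ c) 0    ≡⟨ coeff-+ₚ (a * + 1 ∷ []) (p *ₚ X+ c) 0 ⟩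
  a * + 1 + coeff (p *ₚ X+ c) 0            ≡⟨ cong₂ _+_ (ℤ.*-identityʳ a) (coeff-*ₚX+ p c 0) ⟩
  a + (+ 0 + coeff p 0 * c)                ≡⟨ cong (λ t → a + t) (ℤ.+-identityˡ _) ⟩
  a + coeff p 0 * c                        ∎
  where open ≡-Reasoning
coeff-*ₚX+ (a ∷ p) c (suc (suc n)) =
  trans (coeff-+ₚ (a * + 1 ∷ []) (p *ₚ X+ c) (suc n))
        (trans (ℤ.+-identityˡ _) (coeff-*ₚX+ p c (suc n)))

*ₚX+-congˡ : ∀ p q c → p ≈ₚ q → p *ₚ X+ c ≈ₚ q *ₚ X+ c
*ₚX+-congˡ p q c p≈q n = begin
  coeff (p *ₚ X+ c) n                   ≡⟨ coeff-*ₚX+ p c n ⟩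
  coeff (+ 0 ∷ p) n + coeff p n * c     ≡⟨ cong₂ (λ s t → s + t * c) (shift n) (p≈q n) ⟩
  coeff (+ 0 ∷ q) n + coeff q n * c     ≡⟨ coeff-*ₚX+ q c n ⟨
  coeff (q *ₚ X+ c) n                   ∎
  where
  open ≡-Reasoning
  shift : (+ 0 ∷ p) ≈ₚ (+ 0 ∷ q)
  shift zero    = refl
  shift (suc n) = p≈q n

X+-*ₚ-comm : ∀ c p → X+ c *ₚ p ≈ₚ p *ₚ X+ c
X+-*ₚ-comm c p n = begin
  coeff (X+ c *ₚ p) n                                   ≡⟨ coeff-+ₚ (scaleₚ c p) _ n ⟩
  coeff (scaleₚ c p) n + coeff (+ 0 ∷ one*p) n          ≡⟨ cong₂ _+_ (coeff-scaleₚ c p n) (shift n) ⟩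
  c * coeff p n + coeff (+ 0 ∷ p) n                     ≡⟨ ℤ.+-comm (c * coeff p n) _ ⟩
  coeff (+ 0 ∷ p) n + c * coeff p n                     ≡⟨ cong (λ t → coeff (+ 0 ∷ p) n + t) (ℤ.*-comm c _) ⟩
  coeff (+ 0 ∷ p) n + coeff p n * c                     ≡⟨ coeff-*ₚX+ p c n ⟨
  coeff (p *ₚ X+ c) n                                   ∎
  where
  open ≡-Reasoning
  one*p = (+ 1 ∷ []) *ₚ p
  one*p≈p : one*p ≈ₚ p
  one*p≈p m = begin
    coeff (scaleₚ (+ 1) p +ₚ (+ 0 ∷ [])) m      ≡⟨ coeff-+ₚ (scaleₚ (+ 1) p) _ m ⟩
    coeff (scaleₚ (+ 1) p) m + coeff (+ 0 ∷ []) m ≡⟨ cong₂ _+_ (coeff-scaleₚ (+ 1) p m) ([0]≈ₚ[] m) ⟩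
    + 1 * coeff p m + + 0                       ≡⟨ ℤ.+-identityʳ _ ⟩
    + 1 * coeff p m                             ≡⟨ ℤ.*-identityˡ _ ⟩
    coeff p m                                   ∎
  shift : (+ 0 ∷ one*p) ≈ₚ (+ 0 ∷ p)
  shift zero    = refl
  shift (suc m) = one*p≈p m

eval-+ₚ : ∀ p q x → eval (p +ₚ q) x ≡ eval p x + eval q x
eval-+ₚ []      q       x = sym (ℤ.+-identityˡ _)
eval-+ₚ (a ∷ p) []      x = sym (ℤ.+-identityʳ _)
eval-+ₚ (a ∷ p) (b ∷ q) x = trans (cong (λ t → a + b + x * t) (eval-+ₚ p q x))
                                  (lemma a b x (eval p x) (eval q x))
  where
  lemma : ∀ a b x e f → (a + b) + x * (e + f) ≡ (a + x * e) + (b + x * f)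
  lemma = solve-∀

eval-scaleₚ : ∀ a p x → eval (scaleₚ a p) x ≡ a * eval p x
eval-scaleₚ a []      x = sym (ℤ.*-zeroʳ a)
eval-scaleₚ a (b ∷ p) x = trans (cong (λ t → a * b + x * t) (eval-scaleₚ a p x))
                                (lemma a b x (eval p x))
  where
  lemma : ∀ a b x e → a * b + x * (a * e) ≡ a * (b + x * e)
  lemma = solve-∀

eval-*ₚ : ∀ p q x → eval (p *ₚ q) x ≡ eval p x * eval q x
eval-*ₚ []      q x = refl
eval-*ₚ (a ∷ p) q x = begin
  eval (scaleₚ a q +ₚ (+ 0 ∷ p *ₚ q)) x          ≡⟨ eval-+ₚ (scaleₚ a q) _ x ⟩
  eval (scaleₚ a q) x + (+ 0 + x * eval (p *ₚ q) x)
    ≡⟨ cong₂ (λ s t → s + (+ 0 + x * t)) (eval-scaleₚ a q x) (eval-*ₚ p q x) ⟩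
  a * eval q x + (+ 0 + x * (eval p x * eval q x)) ≡⟨ lemma a x (eval p x) (eval q x) ⟩
  (a + x * eval p x) * eval q x                   ∎
  where
  open ≡-Reasoning
  lemma : ∀ a x e f → a * f + (+ 0 + x * (e * f)) ≡ (a + x * e) * f
  lemma = solve-∀

eval-X+ : ∀ c x → eval (X+ c) x ≡ x + c
eval-X+ = lemma
  where
  lemma : ∀ c x → c + x * (+ 1 + x * + 0) ≡ x + c
  lemma = solve-∀

eval-≈[] : ∀ p x → p ≈ₚ [] → eval p x ≡ + 0
eval-≈[] []      x p≈0 = refl
eval-≈[] (a ∷ p) x p≈0 =
  trans (cong₂ (λ s t → s + x * t) (p≈0 zero) (eval-≈[] p x (λ n → p≈0 (suc n))))
        (trans (ℤ.+-identityˡ _) (ℤ.*-zeroʳ x))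

eval-cong : ∀ p q x → p ≈ₚ q → eval p x ≡ eval q x
eval-cong []      q       x p≈q = sym (eval-≈[] q x (λ n → sym (p≈q n)))
eval-cong (a ∷ p) []      x p≈q = eval-≈[] (a ∷ p) x p≈q
eval-cong (a ∷ p) (b ∷ q) x p≈q =
  cong₂ (λ s t → s + x * t) (p≈q zero) (eval-cong p q x (λ n → p≈q (suc n)))

eval-*ₚX+ : ∀ p c x → eval (p *ₚ X+ c) x ≡ eval p x * (x + c)
eval-*ₚX+ p c x = trans (eval-*ₚ p (X+ c) x) (cong (eval p x *_) (eval-X+ c x))

infixl 6 _-ₚ_
_-ₚ_ : Poly → Poly → Poly
p -ₚ q = p +ₚ scaleₚ (- + 1) q

coeff--ₚ : ∀ p q n → coeff (p -ₚ q) n ≡ coeff p n - coeff q n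
coeff--ₚ p q n = trans (coeff-+ₚ p _ n)
  (cong (λ t → coeff p n + t) (trans (coeff-scaleₚ (- + 1) q n) (ℤ.-1*i≡-i _)))

eval--ₚ : ∀ p q x → eval (p -ₚ q) x ≡ eval p x - eval q x
eval--ₚ p q x = trans (eval-+ₚ p _ x)
  (cong (λ t → eval p x + t) (trans (eval-scaleₚ (- + 1) q x) (ℤ.-1*i≡-i _)))

-ₚ≈⇒≈+ₚ : ∀ u r s → u -ₚ r ≈ₚ s → u ≈ₚ r +ₚ s
-ₚ≈⇒≈+ₚ u r s u-r≈s n = begin
  coeff u n                          ≡⟨ lemma (coeff u n) (coeff r n) ⟩
  coeff r n + (coeff u n - coeff r n) ≡⟨ cong (λ t → coeff r n + t) (coeff--ₚ u r n) ⟨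
  coeff r n + coeff (u -ₚ r) n       ≡⟨ cong (λ t → coeff r n + t) (u-r≈s n) ⟩
  coeff r n + coeff s n              ≡⟨ coeff-+ₚ r s n ⟨
  coeff (r +ₚ s) n                   ∎
  where
  open ≡-Reasoning
  lemma : ∀ a b → a ≡ b + (a - b)
  lemma = solve-∀

-ₚ≈[]⇒≈ : ∀ u r → u -ₚ r ≈ₚ [] → u ≈ₚ r
-ₚ≈[]⇒≈ u r u-r≈0 n = ℤ.i-j≡0⇒i≡j _ _ (trans (sym (coeff--ₚ u r n)) (u-r≈0 n))

-- Division by x + c

-- Synthetic division: the quotient of a + x·w by x + c starts with w(-c).
quotient : ℤ → Poly → Poly
quotient c []              = []
quotient c (_ ∷ [])        = []
quotient c (_ ∷ w@(_ ∷ _)) = eval w (- c) ∷ quotient c w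

length-quotient : ∀ c a w → length (quotient c (a ∷ w)) ≡ length w
length-quotient c a []      = refl
length-quotient c a (b ∷ w) = cong suc (length-quotient c b w)

division : ∀ c w → w ≈ₚ quotient c w *ₚ X+ c +ₚ (eval w (- c) ∷ [])
division c []      zero    = refl
division c []      (suc n) = refl
division c (a ∷ []) zero   = sym (trans (cong (λ t → a + t) (ℤ.*-zeroʳ (- c))) (ℤ.+-identityʳ a))
division c (a ∷ []) (suc n) = refl
division c (a ∷ w@(_ ∷ _)) n =
  trans (coefficients n) (sym (coeff-+ₚ ((r ∷ Q) *ₚ X+ c) (eval (a ∷ w) (- c) ∷ []) n))
  where
  open ≡-Reasoning
  Q = quotient c w
  r = eval w (- c)
  shift : ∀ m → coeff (+ 0 ∷ Q) m + coeff Q m * c + coeff (r ∷ []) m ≡ coeff (r ∷ Q) m + coeff Q m * c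
  shift zero    = lemma (coeff Q 0 * c) r
    where
    lemma : ∀ q r → + 0 + q + r ≡ r + q
    lemma = solve-∀
  shift (suc m) = ℤ.+-identityʳ _
  coefficients : ∀ n → coeff (a ∷ w) n ≡ coeff ((r ∷ Q) *ₚ X+ c) n + coeff (eval (a ∷ w) (- c) ∷ []) n
  coefficients zero = begin
    a                                       ≡⟨ lemma a c r ⟩
    (+ 0 + r * c) + (a + - c * r)           ≡⟨ cong (λ t → t + (a + - c * r)) (coeff-*ₚX+ (r ∷ Q) c 0) ⟨
    coeff ((r ∷ Q) *ₚ X+ c) 0 + (a + - c * r) ∎
    where
    lemma : ∀ a c r → a ≡ (+ 0 + r * c) + (a + - c * r)
    lemma = solve-∀
  coefficients (suc m) = begin
    coeff w m                                            ≡⟨ division c w m ⟩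
    coeff (Q *ₚ X+ c +ₚ (r ∷ [])) m                      ≡⟨ coeff-+ₚ (Q *ₚ X+ c) _ m ⟩
    coeff (Q *ₚ X+ c) m + coeff (r ∷ []) m               ≡⟨ cong (λ t → t + coeff (r ∷ []) m) (coeff-*ₚX+ Q c m) ⟩
    coeff (+ 0 ∷ Q) m + coeff Q m * c + coeff (r ∷ []) m ≡⟨ shift m ⟩
    coeff (r ∷ Q) m + coeff Q m * c                      ≡⟨ coeff-*ₚX+ (r ∷ Q) c (suc m) ⟨
    coeff ((r ∷ Q) *ₚ X+ c) (suc m)                      ≡⟨ ℤ.+-identityʳ _ ⟨
    coeff ((r ∷ Q) *ₚ X+ c) (suc m) + + 0                ∎

factor-theorem : ∀ c w → eval w (- c) ≡ + 0 → w ≈ₚ quotient c w *ₚ X+ c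
factor-theorem c w root n = begin
  coeff w n                                               ≡⟨ division c w n ⟩
  coeff (Q*X +ₚ (eval w (- c) ∷ [])) n                    ≡⟨ coeff-+ₚ Q*X _ n ⟩
  coeff Q*X n + coeff (eval w (- c) ∷ []) n               ≡⟨ cong (λ t → coeff Q*X n + coeff (t ∷ []) n) root ⟩
  coeff Q*X n + coeff (+ 0 ∷ []) n                        ≡⟨ cong (λ t → coeff Q*X n + t) ([0]≈ₚ[] n) ⟩
  coeff Q*X n + + 0                                       ≡⟨ ℤ.+-identityʳ _ ⟩
  coeff Q*X n                                             ∎
  where
  open ≡-Reasoning
  Q*X = quotient c w *ₚ X+ c

root-of-cofactor : ∀ w q c d → w ≈ₚ q *ₚ X+ c → c ≢ d → eval w (- d) ≡ + 0 → eval q (- d) ≡ + 0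
root-of-cofactor w q c d w≈q*X c≢d root =
  [ id , (λ -d+c≡0 → ⊥-elim (c≢d (ℤ.i-j≡0⇒i≡j c d (trans (ℤ.+-comm c (- d)) -d+c≡0)))) ]′
    (ℤ.i*j≡0⇒i≡0∨j≡0 (eval q (- d))
      (trans (sym (eval-*ₚX+ q c (- d))) (trans (sym (eval-cong w (q *ₚ X+ c) (- d) w≈q*X)) root)))

-- Ordered so that p ·∏X+ (c₂ ∷ c₁ ∷ []) is p *ₚ X+ c₁ *ₚ X+ c₂, the shape of Family2 and Family3.
infixl 7 _·∏X+_
_·∏X+_ : Poly → List ℤ → Poly
p ·∏X+ []       = p
p ·∏X+ (c ∷ cs) = p ·∏X+ cs *ₚ X+ c

roots⇒≈·∏X+ : ∀ w cs → Unique cs → All (λ c → eval w (- c) ≡ + 0) cs →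
              Σ Poly λ p → w ≈ₚ p ·∏X+ cs
roots⇒≈·∏X+ w []       _                 _              = w , (λ _ → refl)
roots⇒≈·∏X+ w (c ∷ cs) (c∉cs ∷ distinct) (root ∷ roots)
  with roots⇒≈·∏X+ (quotient c w) cs distinct
         (All.zipWith (λ (c≢d , root′) → root-of-cofactor w (quotient c w) c _ (factor-theorem c w root) c≢d root′)
           (c∉cs , roots))
... | p , q≈p = p , λ n → trans (factor-theorem c w root n) (*ₚX+-congˡ (quotient c w) (p ·∏X+ cs) c q≈p n)

agreeing⇒≈+ₚ·∏X+ : ∀ u r cs → Unique cs → All (λ c → eval u (- c) ≡ eval r (- c)) cs →
                   Σ Poly λ p → u ≈ₚ r +ₚ p ·∏X+ cs
agreeing⇒≈+ₚ·∏X+ u r cs distinct agree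
  with roots⇒≈·∏X+ (u -ₚ r) cs distinct
         (All.map (λ {c} u≡r → trans (eval--ₚ u r (- c)) (ℤ.i≡j⇒i-j≡0 u≡r)) agree)
... | p , u-r≈p = p , -ₚ≈⇒≈+ₚ u r (p ·∏X+ cs) u-r≈p

eval-·∏X+-root : ∀ p {c cs} → c ∈ cs → eval (p ·∏X+ cs) (- c) ≡ + 0
eval-·∏X+-root p {c} {c ∷ cs}  (here refl) =
  trans (eval-*ₚX+ (p ·∏X+ cs) c (- c))
        (trans (cong (eval (p ·∏X+ cs) (- c) *_) (ℤ.+-inverseˡ c)) (ℤ.*-zeroʳ (eval (p ·∏X+ cs) (- c))))
eval-·∏X+-root p {c} {d ∷ cs} (there c∈cs) =
  trans (eval-*ₚX+ (p ·∏X+ cs) d (- c))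
        (trans (cong (_* (- c + d)) (eval-·∏X+-root p c∈cs)) (ℤ.*-zeroˡ (- c + d)))

eval-+ₚ·∏X+ : ∀ u r p cs {c} → u ≈ₚ r +ₚ p ·∏X+ cs → c ∈ cs → eval u (- c) ≡ eval r (- c)
eval-+ₚ·∏X+ u r p cs {c} u≈ c∈cs = begin
  eval u (- c)                             ≡⟨ eval-cong u (r +ₚ p ·∏X+ cs) (- c) u≈ ⟩
  eval (r +ₚ p ·∏X+ cs) (- c)              ≡⟨ eval-+ₚ r (p ·∏X+ cs) (- c) ⟩
  eval r (- c) + eval (p ·∏X+ cs) (- c)    ≡⟨ cong (λ t → eval r (- c) + t) (eval-·∏X+-root p c∈cs) ⟩
  eval r (- c) + + 0                       ≡⟨ ℤ.+-identityʳ _ ⟩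
  eval r (- c)                             ∎
  where open ≡-Reasoning

roots-beyond⇒≈[] : ∀ c w → (∀ d → c ℕ.< d → eval w (- + d) ≡ + 0) → w ≈ₚ []
roots-beyond⇒≈[] c w = go (length w) w refl c
  where
  go : ∀ n w → length w ≡ n → ∀ c → (∀ d → c ℕ.< d → eval w (- + d) ≡ + 0) → w ≈ₚ []
  go _       []      _   _ _     = λ _ → refl
  go (suc n) (a ∷ w) len c roots m = trans (w≈q*X m) (*ₚX+-congˡ q [] (+ suc c) q≈[] m)
    where
    w≈q*X = factor-theorem (+ suc c) (a ∷ w) (roots (suc c) ℕ.≤-refl)
    q = quotient (+ suc c) (a ∷ w)
    q-roots : ∀ d → suc c ℕ.< d → eval q (- + d) ≡ + 0
    q-roots d c+1<d = root-of-cofactor (a ∷ w) q (+ suc c) (+ d) w≈q*X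
      (λ eq → ℕ.<⇒≢ c+1<d (ℤ.+-injective eq)) (roots d (ℕ.<-trans (ℕ.n<1+n c) c+1<d))
    q≈[] : q ≈ₚ []
    q≈[] = go n q (trans (length-quotient _ a w) (ℕ.suc-injective len)) (suc c) q-roots

zero-or-nonzero : ∀ p → p ≈ₚ [] ⊎ NonzeroPoly p
zero-or-nonzero []      = inj₁ (λ _ → refl)
zero-or-nonzero (a ∷ p) with a ≟ + 0 | zero-or-nonzero p
... | no a≢0  | _             = inj₂ (0 , a≢0)
... | yes _   | inj₂ (n , ≢0) = inj₂ (suc n , ≢0)
... | yes a≡0 | inj₁ p≈0      = inj₁ λ { zero → a≡0 ; (suc n) → p≈0 n }

constant-or-DegGe1 : ∀ u → (∀ x → eval u x ≡ coeff u 0) ⊎ DegGe1 u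
constant-or-DegGe1 []      = inj₁ λ _ → refl
constant-or-DegGe1 (a ∷ w) with zero-or-nonzero w
... | inj₂ w≢0 = inj₂ w≢0
... | inj₁ w≈0 = inj₁ λ x →
  trans (cong (λ t → a + x * t) (eval-≈[] w x w≈0))
        (trans (cong (λ t → a + t) (ℤ.*-zeroʳ x)) (ℤ.+-identityʳ a))

-- Elementary number theory

prime⇒2≤ : ∀ {p} → Prime p → 2 ℕ.≤ p
prime⇒2≤ {p} p-prime = ℕ.nonTrivial⇒n>1 p {{prime⇒nonTrivial p-prime}}

prime-∤-1 : ∀ {p} → Prime p → ¬ (+ p ∣ + 1)
prime-∤-1 p-prime p∣1 with ℕ.∣1⇒≡1 (∣⇒∣ᵤ p∣1) | prime⇒2≤ p-prime
... | refl | s≤s ()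

∃-prime-divisor : ∀ n → 2 ℕ.≤ n → ∃ λ p → Prime p × p ℕ.∣ n
∃-prime-divisor (suc zero) (s≤s ())
∃-prime-divisor (suc (suc m)) _ with factorise (suc (suc m))
... | record { factors = [] ; isFactorisation = () }
... | record { factors = p ∷ ps ; isFactorisation = n≡p*∏ ; factorsPrime = p-prime ∷ _ } =
  p , p-prime , ℕ.divides (product ps) (trans n≡p*∏ (ℕ.*-comm p (product ps)))

m≤n⇒m∣n! : ∀ {m n} .{{_ : ℕ.NonZero m}} → m ℕ.≤ n → m ℕ.∣ n !
m≤n⇒m∣n! {suc m} m≤n = ℕ.∣-trans (ℕ.m∣m*n (m !)) (ℕ.m≤n⇒m!∣n! m≤n)

-- Euclid: a prime factor of n! + 1 exceeds n.
∃-prime-above : ∀ n → ∃ λ p → Prime p × n ℕ.< p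
∃-prime-above n with ∃-prime-divisor (suc (n !)) (s≤s (ℕ.1≤n! n))
... | p , p-prime , p∣n!+1 with p ℕ.≤? n
... | no  p≰n = p , p-prime , ℕ.≰⇒> p≰n
... | yes p≤n = ⊥-elim (prime-∤-1 p-prime (∣ᵤ⇒∣ p∣1))
  where
  p∣n! : p ℕ.∣ n !
  p∣n! = m≤n⇒m∣n! {{prime⇒nonZero p-prime}} p≤n
  p∣1 : p ℕ.∣ 1
  p∣1 = ℕ.∣m+n∣m⇒∣n (subst (p ℕ.∣_) (ℕ.+-comm 1 (n !)) p∣n!+1) p∣n!

unit-or-prime-divisor : ∀ z → z ≢ + 0 → z ≡ + 1 ⊎ z ≡ - + 1 ⊎ ∃ λ p → Prime p × + p ∣ z
unit-or-prime-divisor (+ zero)          z≢0 = ⊥-elim (z≢0 refl)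
unit-or-prime-divisor (+ suc zero)      _   = inj₁ refl
unit-or-prime-divisor -[1+ zero ]       _   = inj₂ (inj₁ refl)
unit-or-prime-divisor (+ suc (suc m))   _   with ∃-prime-divisor (suc (suc m)) (s≤s (s≤s z≤n))
... | p , p-prime , p∣z = inj₂ (inj₂ (p , p-prime , ∣ᵤ⇒∣ p∣z))
unit-or-prime-divisor -[1+ suc m ]      _   with ∃-prime-divisor (suc (suc m)) (s≤s (s≤s z≤n))
... | p , p-prime , p∣z = inj₂ (inj₂ (p , p-prime , ∣ᵤ⇒∣ p∣z))

-- X stands for a_{k+1}. With Y = X + (k + 2): every prime p ≤ k divides Y, hence not A = Y - 1,
-- so A = ±1 or the prime k + 1 divides A. In the latter case a prime factor q of B = Y - (k + 1)
-- would divide A - B = k (if q = k + 1) or Y - B = k + 1 (if q ≤ k); so B = ±1 as well.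
module NextValue (k : ℕ) (X : ℤ)
  (divisible    : ∀ i → 1 ℕ.≤ i → i ℕ.≤ k → + i ∣ X + + suc (suc k))
  (small-primes : ∀ j → 1 ℕ.≤ j → j ℕ.≤ suc k → ∀ p → Prime p → + p ∣ X + + j → p ℕ.≤ suc k)
  where

  A B Y : ℤ
  A = X + + suc k
  B = X + + 1
  Y = X + + suc (suc k)

  nonzero : ∀ j → 1 ℕ.≤ j → j ℕ.≤ suc k → X + + j ≢ + 0
  nonzero j 1≤j j≤k+1 X+j≡0 with ∃-prime-above (suc k)
  ... | p , p-prime , k+1<p =
    ℕ.<⇒≱ k+1<p (small-primes j 1≤j j≤k+1 p p-prime (subst (+ p ∣_) (sym X+j≡0) (divides (+ 0) refl)))

  X+[1+n]-[X+1]≡n : ∀ n → X + + suc n - (X + + 1) ≡ + n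
  X+[1+n]-[X+1]≡n n = trans (cong (λ t → X + t - (X + + 1)) (ℤ.pos-+ 1 n)) (lemma X (+ n))
    where
    lemma : ∀ x n → x + (+ 1 + n) - (x + + 1) ≡ n
    lemma = solve-∀

  X+[1+n]-1≡X+n : ∀ n → X + + suc n - + 1 ≡ X + + n
  X+[1+n]-1≡X+n n = trans (cong (λ t → X + t - + 1) (ℤ.pos-+ 1 n)) (lemma X (+ n))
    where
    lemma : ∀ x n → x + (+ 1 + n) - + 1 ≡ x + n
    lemma = solve-∀

  Y-A≡1 : Y - A ≡ + 1
  Y-A≡1 = trans (cong (λ t → X + t - A) (ℤ.pos-+ 1 (suc k))) (lemma X (+ suc k))
    where
    lemma : ∀ x n → x + (+ 1 + n) - (x + n) ≡ + 1
    lemma = solve-∀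

  X≡[X+n]-n : ∀ n → X ≡ X + n - n
  X≡[X+n]-n = lemma X
    where
    lemma : ∀ x n → x ≡ x + n - n
    lemma = solve-∀

  prime-divisor-of-A : ∀ p → Prime p → + p ∣ A → p ≡ suc k
  prime-divisor-of-A p p-prime p∣A
    with ℕ.m≤n⇒m<n∨m≡n (small-primes (suc k) (s≤s z≤n) ℕ.≤-refl p p-prime p∣A)
  ... | inj₂ p≡k+1 = p≡k+1
  ... | inj₁ p<k+1 = ⊥-elim (prime-∤-1 p-prime (subst (+ p ∣_) Y-A≡1 (ℤ.∣m∣n⇒∣m-n p∣Y p∣A)))
    where
    p∣Y : + p ∣ Y
    p∣Y = divisible p (ℕ.<⇒≤ (prime⇒2≤ p-prime)) (ℕ.≤-pred p<k+1)

  no-prime-divisor-of-B : Prime (suc k) → + suc k ∣ A → ∀ q → Prime q → ¬ (+ q ∣ B)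
  no-prime-divisor-of-B k+1-prime k+1∣A q q-prime q∣B
    with ℕ.m≤n⇒m<n∨m≡n (small-primes 1 ℕ.≤-refl (s≤s z≤n) q q-prime q∣B)
  ... | inj₂ refl = ℕ.n≮n k (ℕ.∣⇒≤ {{ℕ.>-nonZero (ℕ.≤-pred (prime⇒2≤ k+1-prime))}} (∣⇒∣ᵤ k+1∣k))
    where
    k+1∣k : + suc k ∣ + k
    k+1∣k = subst (+ suc k ∣_) (X+[1+n]-[X+1]≡n k) (ℤ.∣m∣n⇒∣m-n k+1∣A q∣B)
  ... | inj₁ q<k+1 with prime⇒irreducible k+1-prime (∣⇒∣ᵤ q∣k+1)
    where
    q∣k+1 : + q ∣ + suc k
    q∣k+1 = subst (+ q ∣_) (X+[1+n]-[X+1]≡n (suc k))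
              (ℤ.∣m∣n⇒∣m-n (divisible q (ℕ.<⇒≤ (prime⇒2≤ q-prime)) (ℕ.≤-pred q<k+1)) q∣B)
  ... | inj₁ refl = ℕ.n≮n 1 (prime⇒2≤ q-prime)
  ... | inj₂ refl = ℕ.n≮n q q<k+1

  when-A≡1 : A ≡ + 1 → X ≡ + 0 × k ℕ.≤ 2
  when-A≡1 A≡1 with k ℕ.≟ 0
  ... | yes refl = trans (X≡[X+n]-n (+ 1)) (cong (_- + 1) A≡1) , z≤n
  ... | no  k≢0  = ⊥-elim (nonzero k (ℕ.n≢0⇒n>0 k≢0) (ℕ.n≤1+n k) X+k≡0)
    where
    X+k≡0 : X + + k ≡ + 0
    X+k≡0 = trans (sym (X+[1+n]-1≡X+n k)) (cong (_- + 1) A≡1)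

  when-[1+k]∣A : Prime (suc k) → + suc k ∣ A → X ≡ + 0 × k ℕ.≤ 2
  when-[1+k]∣A k+1-prime k+1∣A with unit-or-prime-divisor B (nonzero 1 ℕ.≤-refl (s≤s z≤n))
  ... | inj₂ (inj₂ (q , q-prime , q∣B)) = ⊥-elim (no-prime-divisor-of-B k+1-prime k+1∣A q q-prime q∣B)
  ... | inj₁ B≡1 = X≡0 , ℕ.∣⇒≤ k∣2
    where
    X≡0 : X ≡ + 0
    X≡0 = trans (X≡[X+n]-n (+ 1)) (cong (_- + 1) B≡1)
    k∣2+k : k ℕ.∣ 2 ℕ.+ k
    k∣2+k = ∣⇒∣ᵤ (subst (λ x → + k ∣ x + + suc (suc k)) X≡0
                         (divisible k (ℕ.≤-pred (prime⇒2≤ k+1-prime)) ℕ.≤-refl))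
    k∣2 : k ℕ.∣ 2
    k∣2 = ℕ.∣m+n∣m⇒∣n (subst (k ℕ.∣_) (ℕ.+-comm 2 k) k∣2+k) ℕ.∣-refl
  ... | inj₂ (inj₁ B≡-1) =
    ⊥-elim (ℕ.n≮n k (ℕ.≤-trans k+1≤∣A∣ (ℕ.≤-trans (ℕ.≤-reflexive ∣A∣≡k∸1) (ℕ.m∸n≤m k 1))))
    where
    X≡-2 : X ≡ -[1+ 1 ]
    X≡-2 = trans (X≡[X+n]-n (+ 1)) (cong (_- + 1) B≡-1)
    ∣A∣≡k∸1 : ∣ A ∣ ≡ k ℕ.∸ 1
    ∣A∣≡k∸1 = cong ∣_∣ (trans (cong (_+ + suc k) X≡-2) (ℤ.⊖-≥ (prime⇒2≤ k+1-prime)))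
    k+1≤∣A∣ : suc k ℕ.≤ ∣ A ∣
    k+1≤∣A∣ = ℕ.∣⇒≤ {{ℕ.≢-nonZero (λ ∣A∣≡0 → nonzero (suc k) (s≤s z≤n) ℕ.≤-refl (ℤ.∣i∣≡0⇒i≡0 ∣A∣≡0))}}
                     (∣⇒∣ᵤ k+1∣A)

  next-value : X ≡ -[1+ suc k ] ⊎ (X ≡ + 0 × k ℕ.≤ 2)
  next-value with unit-or-prime-divisor A (nonzero (suc k) (s≤s z≤n) ℕ.≤-refl)
  ... | inj₁ A≡1                        = inj₂ (when-A≡1 A≡1)
  ... | inj₂ (inj₁ A≡-1)                = inj₁ (trans (X≡[X+n]-n (+ suc k)) (cong (_- + suc k) A≡-1))
  ... | inj₂ (inj₂ (p , p-prime , p∣A)) with prime-divisor-of-A p p-prime p∣A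
  ...   | refl = inj₂ (when-[1+k]∣A p-prime p∣A)

-- The orbit of -1

∣-sub-trans : ∀ {d} x y z → d ∣ x - y → d ∣ y - z → d ∣ x - z
∣-sub-trans {d} x y z d∣x-y d∣y-z = subst (d ∣_) (lemma x y z) (ℤ.∣m∣n⇒∣m+n d∣x-y d∣y-z)
  where
  lemma : ∀ x y z → (x - y) + (y - z) ≡ x - z
  lemma = solve-∀

sub∣eval-sub : ∀ u x y → (x - y) ∣ (eval u x - eval u y)
sub∣eval-sub []      x y = divides (+ 0) refl
sub∣eval-sub (a ∷ p) x y =
  subst ((x - y) ∣_) (sym (lemma a x y (eval p x) (eval p y)))
        (ℤ.∣m∣n⇒∣m+n (ℤ.∣n⇒∣m*n x (sub∣eval-sub p x y)) (ℤ.∣m⇒∣m*n (eval p y) ℤ.∣-refl))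
  where
  lemma : ∀ a x y e f → (a + x * e) - (a + y * f) ≡ x * (e - f) + (x - y) * f
  lemma = solve-∀

orbit-repeats-mod : ∀ {d} f → (∀ x y → d ∣ x - y → d ∣ f x - f y) → ∀ x₀ {j k} → j ℕ.≤ k →
  d ∣ iter f (suc k) x₀ - iter f j x₀ → ∀ m → ∃ λ i → i ℕ.≤ k × d ∣ iter f m x₀ - iter f i x₀
orbit-repeats-mod f f-cong x₀ j≤k d∣ zero = 0 , z≤n , divides (+ 0) (ℤ.+-inverseʳ x₀)
orbit-repeats-mod {d} f f-cong x₀ {j} {k} j≤k d∣ (suc m)
  with orbit-repeats-mod f f-cong x₀ j≤k d∣ m
... | i , i≤k , d∣aₘ-aᵢ with ℕ.m≤n⇒m<n∨m≡n i≤k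
...   | inj₁ i<k  = suc i , i<k , f-cong _ _ d∣aₘ-aᵢ
...   | inj₂ refl = j , j≤k , ∣-sub-trans (iter f (suc m) x₀) _ (iter f j x₀) (f-cong _ _ d∣aₘ-aᵢ) d∣

-[1+]≢0 : ∀ {n} → -[1+ n ] ≢ + 0
-[1+]≢0 ()

orbit : Poly → ℕ → ℤ
orbit u n = iter (eval u) n (- + 1)

StepsDown : Poly → ℕ → Set
StepsDown u k = ∀ i → i ℕ.< k → eval u -[1+ i ] ≡ -[1+ suc i ]

StepsDown-zero : ∀ u → StepsDown u 0
StepsDown-zero u i ()

StepsDown-suc : ∀ u {k} → StepsDown u k → eval u -[1+ k ] ≡ -[1+ suc k ] → StepsDown u (suc k)
StepsDown-suc u steps next i i<k+1 with ℕ.m≤n⇒m<n∨m≡n (ℕ.≤-pred i<k+1)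
... | inj₁ i<k  = steps i i<k
... | inj₂ refl = next

orbit-StepsDown : ∀ u {k} → StepsDown u k → ∀ i → i ℕ.≤ k → orbit u i ≡ -[1+ i ]
orbit-StepsDown u steps zero    _   = refl
orbit-StepsDown u steps (suc i) i<k =
  trans (cong (eval u) (orbit-StepsDown u steps i (ℕ.<⇒≤ i<k))) (steps i i<k)

StepsDown⇒index : ∀ u {k} → StepsDown u k → eval u -[1+ k ] ≡ + 0 → NilpotencyIndex (- + 1) u (suc k)
StepsDown⇒index u {k} steps root =
  s≤s z≤n , trans (cong (eval u) (orbit-StepsDown u steps k ℕ.≤-refl)) root ,
  λ i _ i<k+1 iterᵢ≡0 → -[1+]≢0 (trans (sym (orbit-StepsDown u steps i (ℕ.≤-pred i<k+1))) iterᵢ≡0)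

∣-next-value : ∀ u m i → eval u -[1+ m ] ≡ -[1+ suc m ] →
               + i ∣ eval u -[1+ m ℕ.+ i ] + + suc (suc (m ℕ.+ i))
∣-next-value u m i shift = subst (+ i ∣_) X+m+2+i≡X+m+i+2 (ℤ.∣m∣n⇒∣m+n i∣X+m+2 ℤ.∣-refl)
  where
  X = eval u -[1+ m ℕ.+ i ]
  ∣-[1+m+i]--[1+m]∣≡i : ∣ -[1+ m ℕ.+ i ] - -[1+ m ] ∣ ≡ i
  ∣-[1+m+i]--[1+m]∣≡i = trans (ℤ.∣⊖∣-≤ (s≤s (ℕ.m≤m+n m i))) (ℕ.m+n∸m≡n m i)
  i∣X+m+2 : + i ∣ X + + suc (suc m)
  i∣X+m+2 = ∣ᵤ⇒∣ (subst (ℕ._∣ ∣ X + + suc (suc m) ∣) ∣-[1+m+i]--[1+m]∣≡i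
              (∣⇒∣ᵤ (subst (λ y → _ ∣ X - y) shift (sub∣eval-sub u -[1+ m ℕ.+ i ] -[1+ m ]))))
  X+m+2+i≡X+m+i+2 : X + + suc (suc m) + + i ≡ X + + suc (suc (m ℕ.+ i))
  X+m+2+i≡X+m+i+2 = trans (ℤ.+-assoc X _ (+ i)) (cong (λ t → X + t) (sym (ℤ.pos-+ (suc (suc m)) i)))

-- Modulo p the orbit never leaves a₀, …, a_k, and local nilpotence makes it hit 0 there.
prime-divisor-of-orbit : ∀ u {j k} → LocallyNilpotentAt (- + 1) u → j ℕ.≤ k → ∀ p → Prime p →
  + p ∣ orbit u (suc k) - orbit u j → ∃ λ i → i ℕ.≤ k × + p ∣ orbit u i
prime-divisor-of-orbit u locally-nilpotent j≤k p p-prime p∣aₖ₊₁-aⱼ with locally-nilpotent p p-prime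
... | m , _ , p∣aₘ
  with orbit-repeats-mod (eval u) (λ x y d∣x-y → ℤ.∣-trans d∣x-y (sub∣eval-sub u x y)) (- + 1)
         j≤k p∣aₖ₊₁-aⱼ m
... | i , i≤k , p∣aₘ-aᵢ =
  i , i≤k , subst (+ p ∣_) (lemma (orbit u m) (orbit u i))
                  (ℤ.∣m∣n⇒∣m-n (∣ᵤ⇒∣ {+ p} {orbit u m} p∣aₘ) p∣aₘ-aᵢ)
  where
  lemma : ∀ x y → x - (x - y) ≡ y
  lemma = solve-∀

next-orbit-value : ∀ u k → LocallyNilpotentAt (- + 1) u → StepsDown u k →
                   eval u -[1+ k ] ≡ -[1+ suc k ] ⊎ (eval u -[1+ k ] ≡ + 0 × k ℕ.≤ 2)
next-orbit-value u k locally-nilpotent steps = NextValue.next-value k X divisible small-primes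
  where
  X = eval u -[1+ k ]

  divisible : ∀ i → 1 ℕ.≤ i → i ℕ.≤ k → + i ∣ X + + suc (suc k)
  divisible i 1≤i i≤k = subst (λ n → + i ∣ eval u -[1+ n ] + + suc (suc n)) (ℕ.m∸n+n≡m i≤k)
    (∣-next-value u (k ℕ.∸ i) i (steps (k ℕ.∸ i) (ℕ.∸-monoʳ-< 1≤i i≤k)))

  small-primes : ∀ j → 1 ℕ.≤ j → j ℕ.≤ suc k → ∀ p → Prime p → + p ∣ X + + j → p ℕ.≤ suc k
  small-primes (suc j) _ (s≤s j≤k) p p-prime p∣X+j+1
    with prime-divisor-of-orbit u locally-nilpotent j≤k p p-prime
           (subst₂ (λ x y → + p ∣ eval u x - y)
              (sym (orbit-StepsDown u steps k ℕ.≤-refl)) (sym (orbit-StepsDown u steps j j≤k)) p∣X+j+1)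
  ... | i , i≤k , p∣aᵢ =
    ℕ.≤-trans (ℕ.∣⇒≤ (∣⇒∣ᵤ (subst (+ p ∣_) (orbit-StepsDown u steps i i≤k) p∣aᵢ))) (s≤s i≤k)

StepsDown-beyond-3 : ∀ u → LocallyNilpotentAt (- + 1) u → StepsDown u 3 → ∀ n → StepsDown u (3 ℕ.+ n)
StepsDown-beyond-3 u locally-nilpotent steps₃ zero = steps₃
StepsDown-beyond-3 u locally-nilpotent steps₃ (suc n) =
  [ StepsDown-suc u steps , (λ (_ , 3+n≤2) → ⊥-elim (ℕ.<⇒≱ (ℕ.m≤m+n 3 n) 3+n≤2)) ]′
    (next-orbit-value u (3 ℕ.+ n) locally-nilpotent steps)
  where
  steps : StepsDown u (3 ℕ.+ n)
  steps = StepsDown-beyond-3 u locally-nilpotent steps₃ n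

-- The four families

xMinus1-steps-down : ∀ n → eval xMinus1 -[1+ n ] ≡ -[1+ suc n ]
xMinus1-steps-down n = trans (eval-X+ (- + 1) -[1+ n ]) (cong (λ m → -[1+ suc m ]) (ℕ.+-identityʳ n))

steps-down⇒≈xMinus1 : ∀ u → (∀ n → eval u -[1+ n ] ≡ -[1+ suc n ]) → u ≈ₚ xMinus1
steps-down⇒≈xMinus1 u steps = -ₚ≈[]⇒≈ u xMinus1 (roots-beyond⇒≈[] 0 (u -ₚ xMinus1) roots)
  where
  roots : ∀ d → 0 ℕ.< d → eval (u -ₚ xMinus1) (- + d) ≡ + 0
  roots (suc n) _ = trans (eval--ₚ u xMinus1 -[1+ n ])
    (trans (cong₂ _-_ (steps n) (xMinus1-steps-down n)) (ℤ.+-inverseʳ -[1+ suc n ]))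

root⇒Family1 : ∀ u → DegGe1 u → eval u -[1+ 0 ] ≡ + 0 → Family1 u
root⇒Family1 u (n , coeff≢0) root with zero-or-nonzero (quotient (+ 1) u)
... | inj₂ q≢0 = q , q≢0 , λ m → trans (u≈q*X m) (sym (X+-*ₚ-comm (+ 1) q m))
  where
  q = quotient (+ 1) u
  u≈q*X = factor-theorem (+ 1) u root
... | inj₁ q≈0 = ⊥-elim (coeff≢0 (trans (factor-theorem (+ 1) u root (suc n))
                                        (*ₚX+-congˡ (quotient (+ 1) u) [] (+ 1) q≈0 (suc n))))

values⇒Family2 : ∀ u → eval u -[1+ 0 ] ≡ -[1+ 1 ] → eval u -[1+ 1 ] ≡ + 0 → Family2 u
values⇒Family2 u v₁ v₂ =
  agreeing⇒≈+ₚ·∏X+ u (- + 4 ∷ - + 2 ∷ []) (+ 2 ∷ + 1 ∷ [])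
    (((λ ()) ∷ []) ∷ [] ∷ []) (v₂ ∷ v₁ ∷ [])

values⇒Family3 : ∀ u → eval u -[1+ 0 ] ≡ -[1+ 1 ] → eval u -[1+ 1 ] ≡ -[1+ 2 ] →
                 eval u -[1+ 2 ] ≡ + 0 → Family3 u
values⇒Family3 u v₁ v₂ v₃ =
  agreeing⇒≈+ₚ·∏X+ u (+ 3 ∷ + 7 ∷ + 2 ∷ []) (+ 3 ∷ + 2 ∷ + 1 ∷ [])
    (((λ ()) ∷ (λ ()) ∷ []) ∷ ((λ ()) ∷ []) ∷ [] ∷ []) (v₃ ∷ v₂ ∷ v₁ ∷ [])

locallyNilpotent⇒families : ∀ u → DegGe1 u → LocallyNilpotentAt (- + 1) u →
                            Family1 u ⊎ Family2 u ⊎ Family3 u ⊎ u ≈ₚ xMinus1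
locallyNilpotent⇒families u deg locally-nilpotent =
  [ after₁ , (λ (v₁ , _) → inj₁ (root⇒Family1 u deg v₁)) ]′
    (next-orbit-value u 0 locally-nilpotent (StepsDown-zero u))
  where
  Result = Family1 u ⊎ Family2 u ⊎ Family3 u ⊎ u ≈ₚ xMinus1

  after₃ : StepsDown u 3 → Result
  after₃ steps₃ = inj₂ (inj₂ (inj₂ (steps-down⇒≈xMinus1 u λ n →
    StepsDown-beyond-3 u locally-nilpotent steps₃ n n (ℕ.m≤n+m (suc n) 2))))

  after₂ : StepsDown u 2 → Result
  after₂ steps₂ =
    [ (λ v₃ → after₃ (StepsDown-suc u steps₂ v₃))
    , (λ (v₃ , _) →
         inj₂ (inj₂ (inj₁ (values⇒Family3 u (steps₂ 0 (s≤s z≤n)) (steps₂ 1 ℕ.≤-refl) v₃)))) ]′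
      (next-orbit-value u 2 locally-nilpotent steps₂)

  after₁ : eval u -[1+ 0 ] ≡ -[1+ 1 ] → Result
  after₁ v₁ =
    [ (λ v₂ → after₂ (StepsDown-suc u steps₁ v₂))
    , (λ (v₂ , _) → inj₂ (inj₁ (values⇒Family2 u v₁ v₂))) ]′
      (next-orbit-value u 1 locally-nilpotent steps₁)
    where
    steps₁ : StepsDown u 1
    steps₁ = StepsDown-suc u (StepsDown-zero u) v₁

Family1⇒root : ∀ u → Family1 u → eval u -[1+ 0 ] ≡ + 0
Family1⇒root u (p , _ , u≈) =
  trans (eval-cong u (X+ (+ 1) *ₚ p) -[1+ 0 ] u≈) (eval-*ₚ (X+ (+ 1)) p -[1+ 0 ])

Family2⇒orbit : ∀ u → Family2 u → StepsDown u 1 × eval u -[1+ 1 ] ≡ + 0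
Family2⇒orbit u (p , u≈) = StepsDown-suc u (StepsDown-zero u) (value (there (here refl))) , value (here refl)
  where
  value : ∀ {c} → c ∈ + 2 ∷ + 1 ∷ [] → eval u (- c) ≡ eval (- + 4 ∷ - + 2 ∷ []) (- c)
  value = eval-+ₚ·∏X+ u (- + 4 ∷ - + 2 ∷ []) p (+ 2 ∷ + 1 ∷ []) u≈

Family3⇒orbit : ∀ u → Family3 u → StepsDown u 2 × eval u -[1+ 2 ] ≡ + 0
Family3⇒orbit u (p , u≈) = steps₂ , value (here refl)
  where
  value : ∀ {c} → c ∈ + 3 ∷ + 2 ∷ + 1 ∷ [] → eval u (- c) ≡ eval (+ 3 ∷ + 7 ∷ + 2 ∷ []) (- c)
  value = eval-+ₚ·∏X+ u (+ 3 ∷ + 7 ∷ + 2 ∷ []) p (+ 3 ∷ + 2 ∷ + 1 ∷ []) u≈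
  steps₂ : StepsDown u 2
  steps₂ = StepsDown-suc u (StepsDown-suc u (StepsDown-zero u) (value (there (there (here refl)))))
                           (value (there (here refl)))

Family1-index : ∀ u → Family1 u → NilpotencyIndex (- + 1) u 1
Family1-index u F = StepsDown⇒index u (StepsDown-zero u) (Family1⇒root u F)

Family2-index : ∀ u → Family2 u → NilpotencyIndex (- + 1) u 2
Family2-index u F = uncurry (StepsDown⇒index u) (Family2⇒orbit u F)

Family3-index : ∀ u → Family3 u → NilpotencyIndex (- + 1) u 3
Family3-index u F = uncurry (StepsDown⇒index u) (Family3⇒orbit u F)

index⇒locallyNilpotent : ∀ {r} u {n} → NilpotencyIndex r u n → LocallyNilpotentAt r u
index⇒locallyNilpotent u {n} (1≤n , iterₙ≡0 , _) p _ =
  n , 1≤n , subst (Unsigned._∣_ (+ p)) (sym iterₙ≡0) (ℕ.divides 0 refl)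

-- A constant polynomial reaches 0 after one step or never.
index≥2⇒DegGe1 : ∀ {r} u {n} → NilpotencyIndex r u (suc (suc n)) → DegGe1 u
index≥2⇒DegGe1 {r} u {n} (_ , iter≡0 , minimal) with constant-or-DegGe1 u
... | inj₂ deg   = deg
... | inj₁ const = ⊥-elim (minimal 1 ℕ.≤-refl (s≤s (s≤s z≤n))
                     (trans (const r) (trans (sym (const (iter (eval u) (suc n) r))) iter≡0)))

Family1⇒DegGe1 : ∀ u → Family1 u → DegGe1 u
Family1⇒DegGe1 u F@(p , (n , coeffₙ≢0) , u≈) with constant-or-DegGe1 u
... | inj₂ deg   = deg
... | inj₁ const = ⊥-elim (coeffₙ≢0 (roots-beyond⇒≈[] 1 p roots n))
  where
  roots : ∀ d → 1 ℕ.< d → eval p (- + d) ≡ + 0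
  roots d 1<d = root-of-cofactor u p (+ 1) (+ d) (λ m → trans (u≈ m) (X+-*ₚ-comm (+ 1) p m))
    (λ eq → ℕ.<⇒≢ 1<d (ℤ.+-injective eq))
    (trans (const (- + d)) (trans (sym (const -[1+ 0 ])) (Family1⇒root u F)))

iter-cong : ∀ {f g} → (∀ x → f x ≡ g x) → ∀ n x → iter f n x ≡ iter g n x
iter-cong f≗g zero    x = refl
iter-cong {f} {g} f≗g (suc n) x = trans (f≗g (iter f n x)) (cong g (iter-cong f≗g n x))

LocallyNilpotentAt-resp-≈ₚ : ∀ {r} u v → u ≈ₚ v → LocallyNilpotentAt r v → LocallyNilpotentAt r u
LocallyNilpotentAt-resp-≈ₚ {r} u v u≈v v-nil p p-prime with v-nil p p-prime
... | m , 1≤m , p∣ = m , 1≤m ,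
  subst (Unsigned._∣_ (+ p)) (sym (iter-cong (λ x → eval-cong u v x u≈v) m r)) p∣

orbit-xMinus1 : ∀ n → orbit xMinus1 n ≡ -[1+ n ]
orbit-xMinus1 n = orbit-StepsDown xMinus1 (λ i _ → xMinus1-steps-down i) n ℕ.≤-refl

xMinus1-locallyNilpotent : LocallyNilpotentAt (- + 1) xMinus1
xMinus1-locallyNilpotent zero    0-prime   = ⊥-elim (ℕ.n≮0 (prime⇒2≤ 0-prime))
xMinus1-locallyNilpotent (suc q) q+1-prime =
  q , ℕ.≤-pred (prime⇒2≤ q+1-prime) , subst (Unsigned._∣_ (+ suc q)) (sym (orbit-xMinus1 q)) ℕ.∣-refl

xMinus1-¬nilpotent : ¬ NilpotentAt (- + 1) xMinus1
xMinus1-¬nilpotent (n , _ , iterₙ≡0) = -[1+]≢0 (trans (sym (orbit-xMinus1 n)) iterₙ≡0)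

families⇒DegGe1×locallyNilpotent : ∀ u → Family1 u ⊎ Family2 u ⊎ Family3 u ⊎ u ≈ₚ xMinus1 →
                                   DegGe1 u × LocallyNilpotentAt (- + 1) u
families⇒DegGe1×locallyNilpotent u (inj₁ F) =
  Family1⇒DegGe1 u F , index⇒locallyNilpotent u (Family1-index u F)
families⇒DegGe1×locallyNilpotent u (inj₂ (inj₁ F)) =
  index≥2⇒DegGe1 u (Family2-index u F) , index⇒locallyNilpotent u (Family2-index u F)
families⇒DegGe1×locallyNilpotent u (inj₂ (inj₂ (inj₁ F))) =
  index≥2⇒DegGe1 u (Family3-index u F) , index⇒locallyNilpotent u (Family3-index u F)
families⇒DegGe1×locallyNilpotent u (inj₂ (inj₂ (inj₂ u≈x-1))) =
  (0 , λ coeff₁≡0 → 1≢0 (trans (sym (u≈x-1 1)) coeff₁≡0)) ,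
  LocallyNilpotentAt-resp-≈ₚ u xMinus1 u≈x-1 xMinus1-locallyNilpotent
  where
  1≢0 : + 1 ≢ + 0
  1≢0 ()

corollary4p2 :
    (∀ (u : Poly) →
      (DegGe1 u × LocallyNilpotentAt (- (+ 1)) u)
        ⇔ (Family1 u ⊎ Family2 u ⊎ Family3 u ⊎ u ≈ₚ xMinus1))
    × (∀ u → Family1 u → NilpotencyIndex (- (+ 1)) u 1)
    × (∀ u → Family2 u → NilpotencyIndex (- (+ 1)) u 2)
    × (∀ u → Family3 u → NilpotencyIndex (- (+ 1)) u 3)
    × (LocallyNilpotentAt (- (+ 1)) xMinus1 × ¬ NilpotentAt (- (+ 1)) xMinus1)
corollary4p2 =
  (λ u → mk⇔ (λ (deg , locally-nilpotent) → locallyNilpotent⇒families u deg locally-nilpotent)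
             (families⇒DegGe1×locallyNilpotent u)) ,
  Family1-index , Family2-index , Family3-index , xMinus1-locallyNilpotent , xMinus1-¬nilpotent
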